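{- Let $\Gamma$ be a local type environment and $\mathbb{G}$ a global type tree (balanced, well-formed and projectable onto every participant). If $\Gamma\sqsubseteq\mathbb{G}$ then $\Gamma$ is safe.
   Context: Sorts are $\mathtt{int},\mathtt{bool},\mathtt{nat}$; subsorting $\le$ is the least reflexive relation with $\mathtt{nat}\le\mathtt{int}$. Local type trees are defined coinductively by $T ::= \mathtt{end} \mid \mathtt{p}\&\{\ell_i(S_i).T_i\}_{i\in I} \mid \mathtt{p}\oplus\{\ell_i(S_i).T_i\}_{i\in I}$ with $I$ finite nonempty and the $\ell_i$ distinct. Subtyping $\le$ on local types is the largest relation such that: $\mathtt{end}\le\mathtt{end}$; $\mathtt{p}\&\{\ell_i(S_i).T_i\}_{i\in I\cup J}\le \mathtt{p}\&\{\ell_i(S'_i).T'_i\}_{i\in I}$ if for all $i\in I$, $S'_i\le S_i$ and $T_i\le T'_i$; $\mathtt{p}\oplus\{\ell_i(S_i).T_i\}_{i\in I}\le \mathtt{p}\oplus\{\ell_i(S'_i).T'_i\}_{i\in I\cup J}$ if for all $i\in I$, $S_i\le S'_i$ and $T_i\le T'_i$. Global type trees are defined coinductively by $\mathbb{G} ::= \mathtt{end} \mid \mathtt{p}\to\mathtt{q}:\{\ell_i(S_i).\mathbb{G}_i\}_{i\in I}$ ($I$ finite nonempty). $\mathrm{pt}(\mathbb{G})$ is the least solution of $\mathrm{pt}(\mathtt{end})=\emptyset$, $\mathrm{pt}(\mathtt{p}\to\mathtt{q}:\{\ell_i(S_i).\mathbb{G}_i\}_{i\in I})=\{\mathtt{p},\mathtt{q}\}\cup\bigcup_i\mathrm{pt}(\mathbb{G}_i)$.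 Projection $\upharpoonright_{\mathtt{r}}$ is the largest relation between global and local type trees such that whenever $\mathbb{G}\upharpoonright_{\mathtt{r}}T$: if $\mathtt{r}\notin\mathrm{pt}(\mathbb{G})$ then $T=\mathtt{end}$; if $\mathbb{G}=\mathtt{p}\to\mathtt{r}:\{\ell_i(S_i).\mathbb{G}_i\}_{i\in I}$ then $T=\mathtt{p}\&\{\ell_i(S_i).T_i\}_{i\in I}$ with $\mathbb{G}_i\upharpoonright_{\mathtt{r}}T_i$; if $\mathbb{G}=\mathtt{r}\to\mathtt{q}:\{\ell_i(S_i).\mathbb{G}_i\}_{i\in I}$ then $T=\mathtt{q}\oplus\{\ell_i(S_i).T_i\}_{i\in I}$ with $\mathbb{G}_i\upharpoonright_{\mathtt{r}}T_i$; if $\mathbb{G}=\mathtt{p}\to\mathtt{q}:\{\ell_i(S_i).\mathbb{G}_i\}_{i\in I}$ with $\mathtt{r}\notin\{\mathtt{p},\mathtt{q}\}$ then $\mathbb{G}_i\upharpoonright_{\mathtt{r}}T$ for all $i$. Projection is functional; write $\mathbb{G}\upharpoonright\mathtt{r}$. $\mathbb{G}$ is balanced if for every subtree $\mathbb{G}'$ there is $k$ such that every $\mathtt{p}\in\mathrm{pt}(\mathbb{G}')$ occurs on every path from the root of $\mathbb{G}'$ of length at least $k$ or ending in $\mathtt{end}$. A local type environment $\Gamma$ is a finite map from participants to local type trees (compared by extensional equality); $\Gamma_1,\Gamma_2$ denotes union with disjoint domains. Environment transitions are the least relation with: $\mathtt{p}:\mathtt{q}\&\{\ell_i(S_i).T_i\}_{i\in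 I}\xrightarrow{\mathtt{p}:\mathtt{q}\&\ell_k(S_k)}\mathtt{p}:T_k$ and $\mathtt{p}:\mathtt{q}\oplus\{\ell_i(S_i).T_i\}_{i\in I}\xrightarrow{\mathtt{p}:\mathtt{q}\oplus\ell_k(S_k)}\mathtt{p}:T_k$ for $k\in I$; if $\Gamma\xrightarrow{\alpha}\Gamma'$ then $\Gamma,\mathtt{p}:T\xrightarrow{\alpha}\Gamma',\mathtt{p}:T$; if $\Gamma_1\xrightarrow{\mathtt{p}:\mathtt{q}\oplus\ell(S)}\Gamma_1'$, $\Gamma_2\xrightarrow{\mathtt{q}:\mathtt{p}\&\ell(S')}\Gamma_2'$ and $S\le S'$ then $\Gamma_1,\Gamma_2\xrightarrow{(\mathtt{p},\mathtt{q})\ell}\Gamma'_1,\Gamma'_2$. Write $\Gamma\xrightarrow{\alpha}$ if $\Gamma\xrightarrow{\alpha}\Gamma'$ for some $\Gamma'$, and $\Gamma\to\Gamma'$ if $\Gamma\xrightarrow{(\mathtt{p},\mathtt{q})\ell}\Gamma'$ for some $\mathtt{p},\mathtt{q},\ell$. Association: $\Gamma\sqsubseteq\mathbb{G}$ iff for all $\mathtt{p}\in\mathrm{pt}(\mathbb{G})$, $\mathtt{p}\in\mathrm{dom}(\Gamma)$ and $\Gamma(\mathtt{p})\le\mathbb{G}\upharpoonright\mathtt{p}$, and for all $\mathtt{p}\notin\mathrm{pt}(\mathbb{G})$, either $\mathtt{p}\notin\mathrm{dom}(\Gamma)$ or $\Gamma(\mathtt{p})=\mathtt{end}$. Safety: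 $\mathrm{safe}$ is the largest set of environments such that whenever $\Gamma\in\mathrm{safe}$: (i) if $\Gamma\xrightarrow{\mathtt{p}:\mathtt{q}\oplus\ell(S)}$ and $\Gamma\xrightarrow{\mathtt{q}:\mathtt{p}\&\ell'(S')}$ then $\Gamma\xrightarrow{(\mathtt{p},\mathtt{q})\ell}$; (ii) if $\Gamma\to\Gamma'$ then $\Gamma'\in\mathrm{safe}$. $\Gamma$ is safe iff $\Gamma\in\mathrm{safe}$. -}

module Defs where

open import Data.Nat using (ℕ; zero; suc; _≤_; _≟_)
open import Data.Fin using (Fin; toℕ)
open import Data.List using (List; []; _∷_; map)
open import Data.List.Relation.Unary.Unique.Propositional using (Unique)
open import Data.Maybe using (Maybe; just; nothing)
open import Data.Product using (Σ; Σ-syntax; ∃; _×_; _,_; proj₁)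
open import Data.Sum using (_⊎_)
open import Data.Unit using (⊤)
open import Data.Empty using (⊥)
open import Relation.Nullary using (¬_; yes; no)
open import Relation.Binary.PropositionalEquality using (_≡_; _≢_)
open import Function.Definitions using (Injective)

Part : Set
Part = ℕ

Label : Set
Label = ℕ

data Sort : Set where
  int bool nat : Sort

data _≤ₛ_ : Sort → Sort → Set where
  ≤ₛ-refl : ∀ {S} → S ≤ₛ S
  nat≤int : nat ≤ₛ int

-- Coinductive trees are encoded (without --guardedness) as labelling
-- functions on positions: a position is the list of child indices from
-- the root.  The label of a node records the constructor, partner,
-- the finite nonempty index set Fin (suc n), the (distinct) labels
-- and the payload sorts; the continuations are the subtrees at the
-- child positions.  Labels at positions that are not valid paths are
-- irrelevant (never inspected).

data LNode : Set where
  lend : LNode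
  lbra : Part → (n : ℕ) → (lab : Fin (suc n) → Label) →
         Injective _≡_ _≡_ lab → (Fin (suc n) → Sort) → LNode
  lsel : Part → (n : ℕ) → (lab : Fin (suc n) → Label) →
         Injective _≡_ _≡_ lab → (Fin (suc n) → Sort) → LNode

record LType : Set where
  constructor mkL
  field
    lnode : List ℕ → LNode

open LType public

root : LType → LNode
root T = lnode T []

child : LType → ℕ → LType
child T k = mkL (λ π → lnode T (k ∷ π))

-- Subtyping: the largest relation closed under the given rules,
-- i.e. the union of all post-fixed points of the one-step rule.

SubStep : (LType → LType → Set) → LType → LType → LNode → LNode → Set
SubStep R T U lend lend = ⊤
SubStep R T U (lbra p n lab _ Ss) (lbra p' n' lab' _ Ss') =
  p ≡ p' × ((k' : Fin (suc n')) → Σ[ k ∈ Fin (suc n) ]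
     (lab k ≡ lab' k' × Ss' k' ≤ₛ Ss k × R (child T (toℕ k)) (child U (toℕ k'))))
SubStep R T U (lsel p n lab _ Ss) (lsel p' n' lab' _ Ss') =
  p ≡ p' × ((k : Fin (suc n)) → Σ[ k' ∈ Fin (suc n') ]
     (lab k ≡ lab' k' × Ss k ≤ₛ Ss' k' × R (child T (toℕ k)) (child U (toℕ k'))))
SubStep R T U _ _ = ⊥

_≤ₗ_ : LType → LType → Set₁
T ≤ₗ U = Σ[ R ∈ (LType → LType → Set) ]
           ((∀ {T' U'} → R T' U' → SubStep R T' U' (root T') (root U')) × R T U)

data GNode : Set where
  gend : GNode
  gmsg : Part → Part → (n : ℕ) → (Fin (suc n) → Label) → (Fin (suc n) → Sort) → GNode

record GType : Set where
  constructor mkG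
  field
    gnode : List ℕ → GNode

open GType public

groot : GType → GNode
groot G = gnode G []

gchild : GType → ℕ → GType
gchild G k = mkG (λ π → gnode G (k ∷ π))

data _∈pt_ (r : Part) : GType → Set where
  pt-snd : ∀ {G p q n lab Ss} → groot G ≡ gmsg p q n lab Ss → r ≡ p → r ∈pt G
  pt-rcv : ∀ {G p q n lab Ss} → groot G ≡ gmsg p q n lab Ss → r ≡ q → r ∈pt G
  pt-sub : ∀ {G p q n lab Ss} → groot G ≡ gmsg p q n lab Ss →
           (k : Fin (suc n)) → r ∈pt gchild G (toℕ k) → r ∈pt G

RecvShape : (GType → LType → Set) → Part → (n : ℕ) → (Fin (suc n) → Label) →
            (Fin (suc n) → Sort) → GType → LType → Set
RecvShape R p n lab Ss G T =
  Σ[ lab' ∈ (Fin (suc n) → Label) ] Σ[ inj ∈ Injective _≡_ _≡_ lab' ]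
  Σ[ Ss' ∈ (Fin (suc n) → Sort) ]
    (root T ≡ lbra p n lab' inj Ss' × (∀ k → lab' k ≡ lab k) × (∀ k → Ss' k ≡ Ss k)
     × (∀ (k : Fin (suc n)) → R (gchild G (toℕ k)) (child T (toℕ k))))

SendShape : (GType → LType → Set) → Part → (n : ℕ) → (Fin (suc n) → Label) →
            (Fin (suc n) → Sort) → GType → LType → Set
SendShape R q n lab Ss G T =
  Σ[ lab' ∈ (Fin (suc n) → Label) ] Σ[ inj ∈ Injective _≡_ _≡_ lab' ]
  Σ[ Ss' ∈ (Fin (suc n) → Sort) ]
    (root T ≡ lsel q n lab' inj Ss' × (∀ k → lab' k ≡ lab k) × (∀ k → Ss' k ≡ Ss k)
     × (∀ (k : Fin (suc n)) → R (gchild G (toℕ k)) (child T (toℕ k))))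

ProjCases : (GType → LType → Set) → Part → GType → LType → GNode → Set
ProjCases R r G T gend = ⊤
ProjCases R r G T (gmsg p q n lab Ss) =
  (r ≡ q → RecvShape R p n lab Ss G T) ×
  (r ≡ p → SendShape R q n lab Ss G T) ×
  (r ≢ p → r ≢ q → ∀ (k : Fin (suc n)) → R (gchild G (toℕ k)) T)

ProjStep : (GType → LType → Set) → Part → GType → LType → Set
ProjStep R r G T = (¬ (r ∈pt G) → root T ≡ lend) × ProjCases R r G T (groot G)

Proj : Part → GType → LType → Set₁
Proj r G T = Σ[ R ∈ (GType → LType → Set) ]
               ((∀ {G' T'} → R G' T' → ProjStep R r G' T') × R G T)

Projectable : Part → GType → Set₁
Projectable r G = Σ[ T ∈ LType ] Proj r G T

data Subtree (G' : GType) : GType → Set where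
  sub-here : Subtree G' G'
  sub-under : ∀ {G p q n lab Ss} → groot G ≡ gmsg p q n lab Ss →
              (k : Fin (suc n)) → Subtree G' (gchild G (toℕ k)) → Subtree G' G

data GPath : GType → Set where
  stop : ∀ {G} → GPath G
  step : ∀ {G p q n lab Ss} → groot G ≡ gmsg p q n lab Ss →
         (k : Fin (suc n)) → GPath (gchild G (toℕ k)) → GPath G

pathLength : ∀ {G} → GPath G → ℕ
pathLength stop = zero
pathLength (step _ _ π) = suc (pathLength π)

EndsInEnd : ∀ {G} → GPath G → Set
EndsInEnd {G} stop = groot G ≡ gend
EndsInEnd (step _ _ π) = EndsInEnd π

OccursOn : Part → ∀ {G} → GPath G → Set
OccursOn r stop = ⊥
OccursOn r (step {p = p} {q = q} _ _ π) = r ≡ p ⊎ r ≡ q ⊎ OccursOn r π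

Balanced : GType → Set
Balanced G = ∀ G' → Subtree G' G → Σ[ k ∈ ℕ ]
  (∀ p → p ∈pt G' → (π : GPath G') → (k ≤ pathLength π ⊎ EndsInEnd π) → OccursOn p π)

Env : Set
Env = List (Part × LType)

UniqueKeys : Env → Set
UniqueKeys Γ = Unique (map proj₁ Γ)

lookup : Env → Part → Maybe LType
lookup [] p = nothing
lookup ((q , T) ∷ Γ) p with p ≟ q
... | yes _ = just T
... | no _ = lookup Γ p

update : Env → Part → LType → Env
update [] p T = []
update ((q , U) ∷ Γ) p T with p ≟ q
... | yes _ = (q , T) ∷ update Γ p T
... | no _ = (q , U) ∷ update Γ p T

data LAct : Set where
  lin  : Part → Label → Sort → LAct
  lout : Part → Label → Sort → LAct

data LStep (T : LType) : LAct → LType → Set where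
  lstep-in  : ∀ {q n lab} {inj : Injective _≡_ _≡_ lab} {Ss} → root T ≡ lbra q n lab inj Ss → (k : Fin (suc n)) →
              LStep T (lin q (lab k) (Ss k)) (child T (toℕ k))
  lstep-out : ∀ {q n lab} {inj : Injective _≡_ _≡_ lab} {Ss} → root T ≡ lsel q n lab inj Ss → (k : Fin (suc n)) →
              LStep T (lout q (lab k) (Ss k)) (child T (toℕ k))

data EAct : Set where
  einp : Part → Part → Label → Sort → EAct
  eout : Part → Part → Label → Sort → EAct
  ecom : Part → Part → Label → EAct

data EStep (Γ : Env) : EAct → Env → Set where
  e-inp : ∀ {p q ℓ S T T'} → lookup Γ p ≡ just T → LStep T (lin q ℓ S) T' →
          EStep Γ (einp p q ℓ S) (update Γ p T')
  e-out : ∀ {p q ℓ S T T'} → lookup Γ p ≡ just T → LStep T (lout q ℓ S) T' →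
          EStep Γ (eout p q ℓ S) (update Γ p T')
  e-com : ∀ {p q ℓ S S' T T' U U'} → p ≢ q →
          lookup Γ p ≡ just T → LStep T (lout q ℓ S) T' →
          lookup Γ q ≡ just U → LStep U (lin p ℓ S') U' → S ≤ₛ S' →
          EStep Γ (ecom p q ℓ) (update (update Γ p T') q U')

Can : Env → EAct → Set
Can Γ α = Σ[ Γ' ∈ Env ] EStep Γ α Γ'

_⟶_ : Env → Env → Set
Γ ⟶ Γ' = Σ[ p ∈ Part ] Σ[ q ∈ Part ] Σ[ ℓ ∈ Label ] EStep Γ (ecom p q ℓ) Γ'

_⊑_ : Env → GType → Set₁
Γ ⊑ G =
  (∀ p → p ∈pt G → Σ[ T ∈ LType ] (lookup Γ p ≡ just T ×
                     Σ[ U ∈ LType ] (Proj p G U × T ≤ₗ U))) ×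
  (∀ p → ¬ (p ∈pt G) → lookup Γ p ≡ nothing ⊎ Σ[ T ∈ LType ] (lookup Γ p ≡ just T × root T ≡ lend))

SafeStep : (Env → Set) → Env → Set
SafeStep R Γ =
  (∀ p q ℓ S ℓ' S' → Can Γ (eout p q ℓ S) → Can Γ (einp q p ℓ' S') → Can Γ (ecom p q ℓ)) ×
  (∀ Γ' → Γ ⟶ Γ' → R Γ')

Safe : Env → Set₁
Safe Γ = Σ[ R ∈ (Env → Set) ] ((∀ {Δ} → R Δ → SafeStep R Δ) × R Γ)

{-# OPTIONS --safe #-}
module Submission where

-- Safety is proved by an invariant: the environment is associated
-- with a global type in which, in every subtree, each participant is either
-- absent or met on every branch after finitely many steps (this is what
-- balancedness provides).  Suppose p can send ℓ to q and q waits for p.  The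
-- projections of the global type onto p and q then start with these actions,
-- and as p is met on every branch, each branch passes through messages between
-- other participants only until it reaches a message p → q.  Such a message
-- carries the labels and sorts that both projections exhibit, so q accepts ℓ
-- with a compatible sort (progress), and replacing every such message by its
-- branch ℓ yields a global type associated with the new environment (subject
-- reduction).

open import Defs
open import Data.Nat using (ℕ; zero; suc; _≤_; _≟_; z≤n; s≤s)
open import Data.Fin using (Fin; toℕ) renaming (zero to fzero)
open import Data.Fin.Properties using (any?; all?; ¬∀⟶∃¬)
open import Data.List using (List; []; _∷_)
open import Data.Maybe using (just; nothing)
open import Data.Product using (Σ-syntax; _×_; _,_; proj₁; proj₂)
open import Data.Sum using (_⊎_; inj₁; inj₂; [_,_]′)
open import Data.Unit using (tt)
open import Data.Empty using (⊥; ⊥-elim)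
open import Function using (_∘_)
open import Function.Definitions using (Injective)
open import Relation.Nullary using (¬_; yes; no; Dec)
open import Relation.Nullary.Decidable using (_⊎-dec_; _×-dec_; ¬?)
open import Relation.Binary.PropositionalEquality
  using (_≡_; _≢_; refl; sym; trans; cong; subst; subst₂)
open import Relation.Binary.Construct.Closure.ReflexiveTransitive using (Star; ε; _◅_; _◅◅_)

infix 4 _≈_

_≈_ : GType → GType → Set
G ≈ H = ∀ π → gnode G π ≡ gnode H π

≈-refl : ∀ {G} → G ≈ G
≈-refl π = refl

≈-sym : ∀ {G H} → G ≈ H → H ≈ G
≈-sym G≈H π = sym (G≈H π)

≈-trans : ∀ {G H K} → G ≈ H → H ≈ K → G ≈ K
≈-trans G≈H H≈K π = trans (G≈H π) (H≈K π)

≈-child : ∀ {G H} → G ≈ H → ∀ i → gchild G i ≈ gchild H i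
≈-child G≈H i π = G≈H (i ∷ π)

∈pt-resp-≈ : ∀ {r G H} → G ≈ H → r ∈pt G → r ∈pt H
∈pt-resp-≈ G≈H (pt-snd h r≡p) = pt-snd (trans (sym (G≈H [])) h) r≡p
∈pt-resp-≈ G≈H (pt-rcv h r≡q) = pt-rcv (trans (sym (G≈H [])) h) r≡q
∈pt-resp-≈ G≈H (pt-sub h k r∈) = pt-sub (trans (sym (G≈H [])) h) k (∈pt-resp-≈ (≈-child G≈H (toℕ k)) r∈)

∈pt-inv : ∀ {r G a b n lab Ss} → groot G ≡ gmsg a b n lab Ss → r ∈pt G →
          r ≡ a ⊎ r ≡ b ⊎ Σ[ k ∈ Fin (suc n) ] r ∈pt gchild G (toℕ k)
∈pt-inv h (pt-snd h′ r≡a) with trans (sym h) h′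
... | refl = inj₁ r≡a
∈pt-inv h (pt-rcv h′ r≡b) with trans (sym h) h′
... | refl = inj₂ (inj₁ r≡b)
∈pt-inv h (pt-sub h′ k r∈) with trans (sym h) h′
... | refl = inj₂ (inj₂ (k , r∈))

∉pt-intro : ∀ {r G a b n lab Ss} → groot G ≡ gmsg a b n lab Ss → r ≢ a → r ≢ b →
            (∀ (k : Fin (suc n)) → ¬ r ∈pt gchild G (toℕ k)) → ¬ r ∈pt G
∉pt-intro h r≢a r≢b r∉ r∈ with ∈pt-inv h r∈
... | inj₁ r≡a = r≢a r≡a
... | inj₂ (inj₁ r≡b) = r≢b r≡b
... | inj₂ (inj₂ (k , r∈k)) = r∉ k r∈k

data Unavoidable (r : Part) : GType → Set where
  here  : ∀ {G a b n lab Ss} → groot G ≡ gmsg a b n lab Ss → r ≡ a ⊎ r ≡ b → Unavoidable r G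
  there : ∀ {G a b n lab Ss} → groot G ≡ gmsg a b n lab Ss →
          (∀ (k : Fin (suc n)) → Unavoidable r (gchild G (toℕ k))) → Unavoidable r G

unavoidable-resp-≈ : ∀ {r G H} → G ≈ H → Unavoidable r G → Unavoidable r H
unavoidable-resp-≈ G≈H (here h r∈ab) = here (trans (sym (G≈H [])) h) r∈ab
unavoidable-resp-≈ G≈H (there h u) =
  there (trans (sym (G≈H [])) h) (λ k → unavoidable-resp-≈ (≈-child G≈H _) (u k))

unavoidable⇒∈pt : ∀ {r G} → Unavoidable r G → r ∈pt G
unavoidable⇒∈pt (here h (inj₁ r≡a)) = pt-snd h r≡a
unavoidable⇒∈pt (here h (inj₂ r≡b)) = pt-rcv h r≡b
unavoidable⇒∈pt (there h u) = pt-sub h fzero (unavoidable⇒∈pt (u fzero))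

unavoidable-inv : ∀ {r G a b n lab Ss} → groot G ≡ gmsg a b n lab Ss → Unavoidable r G →
                  (r ≡ a ⊎ r ≡ b) ⊎ ((k : Fin (suc n)) → Unavoidable r (gchild G (toℕ k)))
unavoidable-inv h (here h′ r∈ab) with trans (sym h) h′
... | refl = inj₁ r∈ab
unavoidable-inv h (there h′ u) with trans (sym h) h′
... | refl = inj₂ u

UnavoidableOrAbsent : GType → Part → Set
UnavoidableOrAbsent G r = Unavoidable r G ⊎ ¬ r ∈pt G

-- An inductive form of balancedness.
AllUnavoidable : GType → Set
AllUnavoidable G = ∀ G′ → Subtree G′ G → ∀ r → UnavoidableOrAbsent G′ r

unavoidableOrAbsent-resp-≈ : ∀ {G H r} → G ≈ H → UnavoidableOrAbsent G r → UnavoidableOrAbsent H r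
unavoidableOrAbsent-resp-≈ G≈H (inj₁ u) = inj₁ (unavoidable-resp-≈ G≈H u)
unavoidableOrAbsent-resp-≈ G≈H (inj₂ r∉) = inj₂ (r∉ ∘ ∈pt-resp-≈ (≈-sym G≈H))

∈pt? : ∀ {G r} → UnavoidableOrAbsent G r → Dec (r ∈pt G)
∈pt? (inj₁ u) = yes (unavoidable⇒∈pt u)
∈pt? (inj₂ r∉) = no r∉

allUnavoidable-child : ∀ {G a b n lab Ss} → AllUnavoidable G → groot G ≡ gmsg a b n lab Ss →
                       (k : Fin (suc n)) → AllUnavoidable (gchild G (toℕ k))
allUnavoidable-child allG h k G′ sub = allG G′ (sub-under h k sub)

allUnavoidable-intro : ∀ {G a b n lab Ss} → groot G ≡ gmsg a b n lab Ss →
                       (∀ r → UnavoidableOrAbsent G r) →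
                       ((k : Fin (suc n)) → AllUnavoidable (gchild G (toℕ k))) → AllUnavoidable G
allUnavoidable-intro h atRoot below G′ sub-here = atRoot
allUnavoidable-intro h atRoot below G′ (sub-under h′ k sub) with trans (sym h) h′
... | refl = below k G′ sub

allUnavoidable-resp-≈ : ∀ {G H} → G ≈ H → AllUnavoidable G → AllUnavoidable H
allUnavoidable-resp-≈ G≈H allG G′ sub-here r = unavoidableOrAbsent-resp-≈ G≈H (allG _ sub-here r)
allUnavoidable-resp-≈ G≈H allG G′ (sub-under h k sub) =
  allUnavoidable-resp-≈ (≈-child G≈H (toℕ k))
    (allUnavoidable-child allG (trans (G≈H []) h) k) G′ sub

mutual
  UnavoidableWithin : Part → ℕ → GType → Set
  UnavoidableWithin r zero G = ⊥
  UnavoidableWithin r (suc m) G = UnavoidableWithinAt r m G (groot G)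

  UnavoidableWithinAt : Part → ℕ → GType → GNode → Set
  UnavoidableWithinAt r m G gend = ⊥
  UnavoidableWithinAt r m G (gmsg a b n lab Ss) =
    (r ≡ a ⊎ r ≡ b) ⊎ ((k : Fin (suc n)) → UnavoidableWithin r m (gchild G (toℕ k)))

mutual
  unavoidableWithin? : ∀ r m G → Dec (UnavoidableWithin r m G)
  unavoidableWithin? r zero G = no (λ ())
  unavoidableWithin? r (suc m) G = unavoidableWithinAt? r m G (groot G)

  unavoidableWithinAt? : ∀ r m G node → Dec (UnavoidableWithinAt r m G node)
  unavoidableWithinAt? r m G gend = no (λ ())
  unavoidableWithinAt? r m G (gmsg a b n lab Ss) =
    ((r ≟ a) ⊎-dec (r ≟ b)) ⊎-dec all? (λ k → unavoidableWithin? r m (gchild G (toℕ k)))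

mutual
  unavoidableWithin⇒unavoidable : ∀ {r} m {G} → UnavoidableWithin r m G → Unavoidable r G
  unavoidableWithin⇒unavoidable (suc m) {G} u = unavoidableWithinAt⇒unavoidable m (groot G) refl u

  unavoidableWithinAt⇒unavoidable : ∀ {r} m {G} node → groot G ≡ node →
                                    UnavoidableWithinAt r m G node → Unavoidable r G
  unavoidableWithinAt⇒unavoidable m (gmsg a b n lab Ss) h (inj₁ r∈ab) = here h r∈ab
  unavoidableWithinAt⇒unavoidable m (gmsg a b n lab Ss) h (inj₂ u) =
    there h (λ k → unavoidableWithin⇒unavoidable m (u k))

AvoidingPath : Part → ℕ → GType → Set
AvoidingPath r m G = Σ[ π ∈ GPath G ] (¬ OccursOn r π × (m ≤ pathLength π ⊎ EndsInEnd π))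

mutual
  avoidingPath : ∀ r m G → ¬ UnavoidableWithin r m G → AvoidingPath r m G
  avoidingPath r zero G _ = stop , (λ ()) , inj₁ z≤n
  avoidingPath r (suc m) G ¬u = avoidingPathAt r m G (groot G) refl ¬u

  avoidingPathAt : ∀ r m G node → groot G ≡ node → ¬ UnavoidableWithinAt r m G node →
                   AvoidingPath r (suc m) G
  avoidingPathAt r m G gend h ¬u = stop , (λ ()) , inj₂ h
  avoidingPathAt r m G (gmsg a b n lab Ss) h ¬u
    with ¬∀⟶∃¬ (suc n) _ (λ k → unavoidableWithin? r m (gchild G (toℕ k))) (¬u ∘ inj₂)
  ... | k , ¬uₖ with avoidingPath r m (gchild G (toℕ k)) ¬uₖ
  ...   | π , r∉π , long = step h k π , r∉π′ , longer long
    where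
    r∉π′ : ¬ OccursOn r (step {G} h k π)
    r∉π′ (inj₁ r≡a) = ¬u (inj₁ (inj₁ r≡a))
    r∉π′ (inj₂ (inj₁ r≡b)) = ¬u (inj₁ (inj₂ r≡b))
    r∉π′ (inj₂ (inj₂ r∈π)) = r∉π r∈π

    longer : m ≤ pathLength π ⊎ EndsInEnd π →
             suc m ≤ pathLength (step {G} h k π) ⊎ EndsInEnd (step {G} h k π)
    longer (inj₁ m≤) = inj₁ (s≤s m≤)
    longer (inj₂ ends) = inj₂ ends

-- A participant that every long or maximal path meets is unavoidable: decide
-- unavoidability up to the balancing bound, and otherwise exhibit an avoiding path.
balanced⇒allUnavoidable : ∀ {G} → Balanced G → AllUnavoidable G
balanced⇒allUnavoidable balanced G′ sub r with balanced G′ sub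
... | bound , meets with unavoidableWithin? r bound G′
...   | yes u = inj₁ (unavoidableWithin⇒unavoidable bound u)
...   | no ¬u with avoidingPath r bound G′ ¬u
...     | π , r∉π , long = inj₂ (λ r∈ → r∉π (meets r r∈ π long))

data Head : Set where
  done    : Head
  from to : Part → Head

lhead : LNode → Head
lhead lend = done
lhead (lbra p _ _ _ _) = from p
lhead (lsel q _ _ _ _) = to q

from≢to : ∀ {a b} → from a ≢ to b
from≢to ()

from-injective : ∀ {a b} → from a ≡ from b → a ≡ b
from-injective refl = refl

to-injective : ∀ {a b} → to a ≡ to b → a ≡ b
to-injective refl = refl

lhead-done : ∀ {x} → lhead x ≡ done → x ≡ lend
lhead-done {lend} _ = refl

end? : (x : LNode) → Dec (x ≡ lend)
end? lend = yes refl
end? (lbra _ _ _ _ _) = no (λ ())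
end? (lsel _ _ _ _ _) = no (λ ())

≤ₛ-trans : ∀ {S₁ S₂ S₃} → S₁ ≤ₛ S₂ → S₂ ≤ₛ S₃ → S₁ ≤ₛ S₃
≤ₛ-trans ≤ₛ-refl S₂≤S₃ = S₂≤S₃
≤ₛ-trans nat≤int ≤ₛ-refl = nat≤int

≤ₗ-head : ∀ {T U} → T ≤ₗ U → lhead (root T) ≡ lhead (root U)
≤ₗ-head {T} {U} (R , closed , rel) = heads (root T) (root U) (closed rel)
  where
  heads : ∀ x y → SubStep R T U x y → lhead x ≡ lhead y
  heads lend lend _ = refl
  heads (lbra _ _ _ _ _) (lbra _ _ _ _ _) (refl , _) = refl
  heads (lsel _ _ _ _ _) (lsel _ _ _ _ _) (refl , _) = refl

≤ₗ-end : ∀ {T U} → T ≤ₗ U → root U ≡ lend → root T ≡ lend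
≤ₗ-end T≤U U-end = lhead-done (trans (≤ₗ-head T≤U) (cong lhead U-end))

LStep-out-head : ∀ {T q ℓ S T′} → LStep T (lout q ℓ S) T′ → lhead (root T) ≡ to q
LStep-out-head (lstep-out e _) = cong lhead e

LStep-in-head : ∀ {T p ℓ S T′} → LStep T (lin p ℓ S) T′ → lhead (root T) ≡ from p
LStep-in-head (lstep-in e _) = cong lhead e

LStep-in-deterministic : ∀ {T p p′ ℓ ℓ′ S S′ T₁ T₂} →
                         LStep T (lin p ℓ S) T₁ → LStep T (lin p′ ℓ′ S′) T₂ → ℓ ≡ ℓ′ → T₁ ≡ T₂
LStep-in-deterministic {T} (lstep-in {inj = inj} e k) (lstep-in e′ k′) ℓ≡ℓ′ with trans (sym e) e′
... | refl = cong (child T ∘ toℕ) (inj ℓ≡ℓ′)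

LStep-not-end : ∀ {T α T′} → LStep T α T′ → root T ≢ lend
LStep-not-end (lstep-in e _) T-end with trans (sym e) T-end
... | ()
LStep-not-end (lstep-out e _) T-end with trans (sym e) T-end
... | ()

≤ₗ-out : ∀ {T U q ℓ S T′} → T ≤ₗ U → LStep T (lout q ℓ S) T′ →
         Σ[ S′ ∈ Sort ] Σ[ U′ ∈ LType ] (S ≤ₛ S′ × LStep U (lout q ℓ S′) U′ × T′ ≤ₗ U′)
≤ₗ-out {T} {U} (R , closed , rel) (lstep-out {q} {n} {lab} {inj} {Ss} e k) =
  answer (root U) refl (subst (λ x → SubStep R T U x (root U)) e (closed rel))
  where
  answer : ∀ y → root U ≡ y → SubStep R T U (lsel q n lab inj Ss) y →
           Σ[ S′ ∈ Sort ] Σ[ U′ ∈ LType ]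
             (Ss k ≤ₛ S′ × LStep U (lout q (lab k) S′) U′ × child T (toℕ k) ≤ₗ U′)
  answer (lsel _ _ lab′ _ Ss′) eU (refl , match) with match k
  ... | k′ , lab≡ , S≤ , rel′ =
    Ss′ k′ , child U (toℕ k′) , S≤ ,
    subst (λ ℓ → LStep U (lout q ℓ (Ss′ k′)) _) (sym lab≡) (lstep-out eU k′) , (R , closed , rel′)

≤ₗ-in : ∀ {T U p ℓ S U′} → T ≤ₗ U → LStep U (lin p ℓ S) U′ →
        Σ[ S′ ∈ Sort ] Σ[ T′ ∈ LType ] (S ≤ₛ S′ × LStep T (lin p ℓ S′) T′ × T′ ≤ₗ U′)
≤ₗ-in {T} {U} (R , closed , rel) (lstep-in {p} {n} {lab} {inj} {Ss} e k) =
  answer (root T) refl (subst (SubStep R T U (root T)) e (closed rel))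
  where
  answer : ∀ x → root T ≡ x → SubStep R T U x (lbra p n lab inj Ss) →
           Σ[ S′ ∈ Sort ] Σ[ T′ ∈ LType ]
             (Ss k ≤ₛ S′ × LStep T (lin p (lab k) S′) T′ × T′ ≤ₗ child U (toℕ k))
  answer (lbra _ _ lab′ _ Ss′) eT (refl , match) with match k
  ... | k′ , lab≡ , S≤ , rel′ =
    Ss′ k′ , child T (toℕ k′) , S≤ ,
    subst (λ ℓ → LStep T (lin p ℓ (Ss′ k′)) _) lab≡ (lstep-in eT k′) , (R , closed , rel′)

module _ {R R′ : GType → LType → Set} {Y X : GType} {T : LType} where
  private
    ChildMap : ℕ → Set
    ChildMap n = (k : Fin (suc n)) → ∀ {U} → R (gchild Y (toℕ k)) U → R′ (gchild X (toℕ k)) U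

  ProjCases-map : ∀ {r} node →
    (∀ {a b n lab Ss} → node ≡ gmsg a b n lab Ss → ChildMap n) →
    ProjCases R r Y T node → ProjCases R′ r X T node
  ProjCases-map gend f _ = tt
  ProjCases-map (gmsg a b n lab Ss) f (asReceiver , asSender , asBystander) =
    (λ r≡b → receiver (asReceiver r≡b)) ,
    (λ r≡a → sender (asSender r≡a)) ,
    (λ r≢a r≢b k → f refl k (asBystander r≢a r≢b k))
    where
    receiver : RecvShape R a n lab Ss Y T → RecvShape R′ a n lab Ss X T
    receiver (lab′ , inj , Ss′ , root≡ , lab≗ , Ss≗ , children) =
      lab′ , inj , Ss′ , root≡ , lab≗ , Ss≗ , (λ k → f refl k (children k))

    sender : SendShape R b n lab Ss Y T → SendShape R′ b n lab Ss X T
    sender (lab′ , inj , Ss′ , root≡ , lab≗ , Ss≗ , children) =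
      lab′ , inj , Ss′ , root≡ , lab≗ , Ss≗ , (λ k → f refl k (children k))

  ProjStep-map : ∀ {r} → (¬ r ∈pt X → ¬ r ∈pt Y) → groot X ≡ groot Y →
    (∀ {a b n lab Ss} → groot Y ≡ gmsg a b n lab Ss → ChildMap n) →
    ProjStep R r Y T → ProjStep R′ r X T
  ProjStep-map {r} ∉pt-back roots≡ f (absent , cases) =
    absent ∘ ∉pt-back ,
    subst (ProjCases R′ r X T) (sym roots≡) (ProjCases-map (groot Y) f cases)

Proj-resp-≈ : ∀ {r G H T} → G ≈ H → Proj r G T → Proj r H T
Proj-resp-≈ {r} {G} {H} {T} G≈H (R , closed , rel) = R≈ , closed≈ , (G , G≈H , rel)
  where
  R≈ : GType → LType → Set
  R≈ X U = Σ[ Y ∈ GType ] (Y ≈ X × R Y U)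

  closed≈ : ∀ {X U} → R≈ X U → ProjStep R≈ r X U
  closed≈ (Y , Y≈X , rel′) =
    ProjStep-map (λ r∉X → r∉X ∘ ∈pt-resp-≈ Y≈X) (sym (Y≈X []))
      (λ _ k rel″ → _ , ≈-child Y≈X _ , rel″) (closed rel′)

proj-sub : ∀ {r G U G′ U′} (pr : Proj r G U) → proj₁ pr G′ U′ → Proj r G′ U′
proj-sub (R , closed , _) rel = R , closed , rel

projStep : ∀ {r G U} (pr : Proj r G U) → ProjStep (proj₁ pr) r G U
projStep (R , closed , rel) = closed rel

projCases : ∀ {r G U a b n lab Ss} (pr : Proj r G U) → groot G ≡ gmsg a b n lab Ss →
            ProjCases (proj₁ pr) r G U (gmsg a b n lab Ss)
projCases {r} {G} {U} pr h = subst (ProjCases (proj₁ pr) r G U) h (proj₂ (projStep pr))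

proj-∉pt : ∀ {r G U} → Proj r G U → ¬ r ∈pt G → root U ≡ lend
proj-∉pt pr = proj₁ (projStep pr)

proj-child : ∀ {r G U a b n lab Ss} → Proj r G U → groot G ≡ gmsg a b n lab Ss → r ≢ a → r ≢ b →
             (k : Fin (suc n)) → Proj r (gchild G (toℕ k)) U
proj-child pr h r≢a r≢b k = proj-sub pr (proj₂ (proj₂ (projCases pr h)) r≢a r≢b k)

proj-intro-bystander : ∀ {r G V a b n lab Ss} → groot G ≡ gmsg a b n lab Ss → r ≢ a → r ≢ b →
                       ((k : Fin (suc n)) → Proj r (gchild G (toℕ k)) V) → Proj r G V
proj-intro-bystander {r} {G} {V} {n = n} h r≢a r≢b children = R , closed , inj₁ (refl , refl)
  where
  R : GType → LType → Set
  R G′ U = (G′ ≡ G × U ≡ V) ⊎ Σ[ k ∈ Fin (suc n) ] proj₁ (children k) G′ U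

  closed : ∀ {G′ U} → R G′ U → ProjStep R r G′ U
  closed (inj₁ (refl , refl)) =
    (λ r∉G → proj-∉pt (children fzero) (r∉G ∘ pt-sub h fzero)) ,
    subst (ProjCases R r G V) (sym h)
      ((⊥-elim ∘ r≢b) , (⊥-elim ∘ r≢a) , (λ _ _ k → inj₂ (k , proj₂ (proj₂ (children k)))))
  closed (inj₂ (k , rel)) =
    ProjStep-map (λ r∉ → r∉) refl (λ _ _ rel′ → inj₂ (k , rel′)) (proj₁ (proj₂ (children k)) rel)

proj-head : ∀ {r G U a b n lab Ss} → Proj r G U → groot G ≡ gmsg a b n lab Ss →
            (r ≡ a → lhead (root U) ≡ to b) × (r ≡ b → lhead (root U) ≡ from a)
proj-head pr h with projCases pr h
... | asReceiver , asSender , _ =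
  (λ r≡a → cong lhead (proj₁ (proj₂ (proj₂ (proj₂ (asSender r≡a)))))) ,
  (λ r≡b → cong lhead (proj₁ (proj₂ (proj₂ (proj₂ (asReceiver r≡b))))))

unavoidable⇒proj-not-end : ∀ {r G U} → Unavoidable r G → Proj r G U → root U ≢ lend
unavoidable⇒proj-not-end (here h (inj₁ r≡a)) pr U-end
  with trans (sym (proj₁ (proj-head pr h) r≡a)) (cong lhead U-end)
... | ()
unavoidable⇒proj-not-end (here h (inj₂ r≡b)) pr U-end
  with trans (sym (proj₂ (proj-head pr h) r≡b)) (cong lhead U-end)
... | ()
unavoidable⇒proj-not-end {r} (there {a = a} {b = b} h u) pr with r ≟ a | r ≟ b
... | yes r≡a | _ = unavoidable⇒proj-not-end (here h (inj₁ r≡a)) pr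
... | no _ | yes r≡b = unavoidable⇒proj-not-end (here h (inj₂ r≡b)) pr
... | no r≢a | no r≢b = unavoidable⇒proj-not-end (u fzero) (proj-child pr h r≢a r≢b fzero)

unavoidable-from-proj : ∀ {r G U} → UnavoidableOrAbsent G r → Proj r G U → root U ≢ lend →
                        Unavoidable r G
unavoidable-from-proj (inj₁ u) _ _ = u
unavoidable-from-proj (inj₂ r∉) pr U-not-end = ⊥-elim (U-not-end (proj-∉pt pr r∉))

-- All children project onto r as the same V, so r is unavoidable in all of
-- them (V ≠ end) or absent from all of them (V = end).
unavoidableOrAbsent-uniform : ∀ {r X V a b n lab Ss} → groot X ≡ gmsg a b n lab Ss → r ≢ a → r ≢ b →
  ((k : Fin (suc n)) → UnavoidableOrAbsent (gchild X (toℕ k)) r) →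
  ((k : Fin (suc n)) → Proj r (gchild X (toℕ k)) V) → UnavoidableOrAbsent X r
unavoidableOrAbsent-uniform {r} {X} {V} {n = n} h r≢a r≢b children proj with end? (root V)
... | yes V-end = inj₂ (∉pt-intro h r≢a r≢b absent)
  where
  absent : (k : Fin (suc n)) → ¬ r ∈pt gchild X (toℕ k)
  absent k with children k
  ... | inj₁ u = ⊥-elim (unavoidable⇒proj-not-end u (proj k) V-end)
  ... | inj₂ r∉ = r∉
... | no V-not-end = inj₁ (there h unavoidable)
  where
  unavoidable : (k : Fin (suc n)) → Unavoidable r (gchild X (toℕ k))
  unavoidable k with children k
  ... | inj₁ u = u
  ... | inj₂ r∉ = ⊥-elim (V-not-end (proj-∉pt (proj k) r∉))

lookup-update-≡ : ∀ Γ {p T T′} → lookup Γ p ≡ just T → lookup (update Γ p T′) p ≡ just T′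
lookup-update-≡ ((s , U) ∷ Γ) {p} found with p ≟ s
... | yes p≡s with p ≟ s
...   | yes _ = refl
...   | no p≢s = ⊥-elim (p≢s p≡s)
lookup-update-≡ ((s , U) ∷ Γ) {p} found | no p≢s with p ≟ s
...   | yes p≡s = ⊥-elim (p≢s p≡s)
...   | no _ = lookup-update-≡ Γ found

lookup-update-≢ : ∀ Γ {p r} T′ → r ≢ p → lookup (update Γ p T′) r ≡ lookup Γ r
lookup-update-≢ [] T′ r≢p = refl
lookup-update-≢ ((s , U) ∷ Γ) {p} {r} T′ r≢p with p ≟ s
... | yes refl with r ≟ s
...   | yes refl = ⊥-elim (r≢p refl)
...   | no _ = lookup-update-≢ Γ T′ r≢p
lookup-update-≢ ((s , U) ∷ Γ) {p} {r} T′ r≢p | no _ with r ≟ s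
...   | yes _ = refl
...   | no _ = lookup-update-≢ Γ T′ r≢p

sender≢receiver : ∀ {Δ p q T U ℓ ℓ′ S S′ T′ U′} → lookup Δ p ≡ just T → LStep T (lout q ℓ S) T′ →
                  lookup Δ q ≡ just U → LStep U (lin p ℓ′ S′) U′ → p ≢ q
sender≢receiver foundT send foundU receive refl with trans (sym foundT) foundU
... | refl = from≢to (trans (sym (LStep-in-head receive)) (LStep-out-head send))

Idle : Env → Part → Set
Idle Δ r = lookup Δ r ≡ nothing ⊎ Σ[ T ∈ LType ] (lookup Δ r ≡ just T × root T ≡ lend)

idle-resp : ∀ {Δ Δ′ r} → lookup Δ′ r ≡ lookup Δ r → Idle Δ r → Idle Δ′ r
idle-resp same idle rewrite same = idle

⊑-lookup : ∀ {Δ G r T} → Δ ⊑ G → UnavoidableOrAbsent G r → lookup Δ r ≡ just T → root T ≢ lend →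
           Σ[ U ∈ LType ] (Proj r G U × T ≤ₗ U)
⊑-lookup {r = r} (associated , idle) uoa found T-not-end with ∈pt? uoa
... | yes r∈ with associated r r∈
...   | T′ , found′ , U , pr , T′≤U with trans (sym found) found′
...     | refl = U , pr , T′≤U
⊑-lookup {r = r} (associated , idle) uoa found T-not-end | no r∉ with idle r r∉
...   | inj₁ missing with trans (sym found) missing
...     | ()
⊑-lookup {r = r} (associated , idle) uoa found T-not-end | no r∉ | inj₂ (T′ , found′ , T′-end)
      with trans (sym found) found′
...     | refl = ⊥-elim (T-not-end T′-end)

module Communication (p q : Part) (ℓ : Label) where

  Apart : Part → Part → Set
  Apart a b = p ≢ a × p ≢ b × q ≢ a × q ≢ b

  apart? : ∀ a b → Dec (Apart a b)
  apart? a b = ¬? (p ≟ a) ×-dec ¬? (p ≟ b) ×-dec ¬? (q ≟ a) ×-dec ¬? (q ≟ b)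

  redex? : ∀ a b → Dec (a ≡ p × b ≡ q)
  redex? a b = (a ≟ p) ×-dec (b ≟ q)

  find : ∀ {n} → (Fin (suc n) → Label) → Fin (suc n)
  find lab with any? (λ k → lab k ≟ ℓ)
  ... | yes (k , _) = k
  ... | no _ = fzero

  find-index : ∀ {n} {lab lab′ : Fin (suc n) → Label} → Injective _≡_ _≡_ lab′ →
               (∀ k → lab′ k ≡ lab k) → ∀ k → lab′ k ≡ ℓ → find lab ≡ k
  find-index {lab = lab} {lab′} inj lab≗ k labₖ≡ℓ with any? (λ k → lab k ≟ ℓ)
  ... | yes (k′ , labₖ′≡ℓ) = inj (trans (lab≗ k′) (trans labₖ′≡ℓ (sym labₖ≡ℓ)))
  ... | no none = ⊥-elim (none (k , trans (sym (lab≗ k)) labₖ≡ℓ))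

  -- Position π of reduct G is position origin G π of G.  A redex p → q is
  -- replaced by its branch ℓ and a node apart from p and q is kept.  From a node
  -- that involves p or q in any other way the tree is left unchanged; this junk
  -- case never occurs above the redexes of an Enabled tree.
  mutual
    origin : GType → List ℕ → List ℕ
    origin G π = originAt G (groot G) π

    originAt : GType → GNode → List ℕ → List ℕ
    originAt G gend π = π
    originAt G (gmsg a b n lab Ss) π = originBy G lab (redex? a b) (apart? a b) π

    originBy : ∀ {a b n} → GType → (Fin (suc n) → Label) →
               Dec (a ≡ p × b ≡ q) → Dec (Apart a b) → List ℕ → List ℕ
    originBy G lab (yes _) _ π = toℕ (find lab) ∷ π
    originBy G lab (no _) (yes _) π = originBelow G π
    originBy G lab (no _) (no _) π = π

    originBelow : GType → List ℕ → List ℕ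
    originBelow G [] = []
    originBelow G (i ∷ π) = i ∷ origin (gchild G i) π

  reduct : GType → GType
  reduct G = mkG (gnode G ∘ origin G)

  origin-redex : ∀ {G n lab Ss} → groot G ≡ gmsg p q n lab Ss → ∀ π → origin G π ≡ toℕ (find lab) ∷ π
  origin-redex {G} {lab = lab} h π = trans (cong (λ node → originAt G node π) h) atRedex
    where
    atRedex : originBy G lab (redex? p q) (apart? p q) π ≡ toℕ (find lab) ∷ π
    atRedex with redex? p q
    ... | yes _ = refl
    ... | no ¬redex = ⊥-elim (¬redex (refl , refl))

  origin-apart : ∀ {G a b n lab Ss} → groot G ≡ gmsg a b n lab Ss → Apart a b →
                 ∀ π → origin G π ≡ originBelow G π
  origin-apart {G} {a} {b} {lab = lab} h apart@(p≢a , _) π =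
    trans (cong (λ node → originAt G node π) h) atApart
    where
    atApart : originBy G lab (redex? a b) (apart? a b) π ≡ originBelow G π
    atApart with redex? a b | apart? a b
    ... | yes (a≡p , _) | _ = ⊥-elim (p≢a (sym a≡p))
    ... | no _ | yes _ = refl
    ... | no _ | no ¬apart = ⊥-elim (¬apart apart)

  reduct-redex : ∀ G {n lab Ss} → groot G ≡ gmsg p q n lab Ss → reduct G ≈ gchild G (toℕ (find lab))
  reduct-redex G h π = cong (gnode G) (origin-redex {G} h π)

  reduct-root : ∀ G {a b n lab Ss} → groot G ≡ gmsg a b n lab Ss → Apart a b →
                groot (reduct G) ≡ gmsg a b n lab Ss
  reduct-root G h apart = trans (cong (gnode G) (origin-apart {G} h apart [])) h

  reduct-child : ∀ G {a b n lab Ss} → groot G ≡ gmsg a b n lab Ss → Apart a b →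
                 ∀ i → gchild (reduct G) i ≈ reduct (gchild G i)
  reduct-child G h apart i π = cong (gnode G) (origin-apart {G} h apart (i ∷ π))

  data Enabled (G : GType) : Set where
    at-redex : ∀ {n lab Ss} → groot G ≡ gmsg p q n lab Ss → Enabled G
    under    : ∀ {a b n lab Ss} → groot G ≡ gmsg a b n lab Ss → Apart a b →
               ((k : Fin (suc n)) → Enabled (gchild G (toℕ k))) → Enabled G

  redex-or-apart : ∀ {G Up Uq a b n lab Ss} → groot G ≡ gmsg a b n lab Ss →
                   Proj p G Up → lhead (root Up) ≡ to q → Proj q G Uq → lhead (root Uq) ≡ from p →
                   (a ≡ p × b ≡ q) ⊎ Apart a b
  redex-or-apart {a = a} {b} h prp hp prq hq with p ≟ a | p ≟ b | q ≟ a | q ≟ b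
  ... | yes refl | _ | _ | _ =
    inj₁ (refl , to-injective (trans (sym (proj₁ (proj-head prp h) refl)) hp))
  ... | no _ | yes refl | _ | _ = ⊥-elim (from≢to (trans (sym (proj₂ (proj-head prp h) refl)) hp))
  ... | no _ | no _ | yes refl | _ = ⊥-elim (from≢to (trans (sym hq) (proj₁ (proj-head prq h) refl)))
  ... | no p≢a | no _ | no _ | yes refl =
    ⊥-elim (p≢a (from-injective (trans (sym hq) (proj₂ (proj-head prq h) refl))))
  ... | no p≢a | no p≢b | no q≢a | no q≢b = inj₂ (p≢a , p≢b , q≢a , q≢b)

  enabled : ∀ {G Up Uq} → Unavoidable p G →
            Proj p G Up → lhead (root Up) ≡ to q → Proj q G Uq → lhead (root Uq) ≡ from p → Enabled G
  enabled (here h p∈ab) prp hp prq hq with redex-or-apart h prp hp prq hq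
  ... | inj₁ (refl , refl) = at-redex h
  ... | inj₂ (p≢a , p≢b , _) = ⊥-elim ([ p≢a , p≢b ]′ p∈ab)
  enabled (there h u) prp hp prq hq with redex-or-apart h prp hp prq hq
  ... | inj₁ (refl , refl) = at-redex h
  ... | inj₂ apart@(p≢a , p≢b , q≢a , q≢b) =
    under h apart (λ k → enabled (u k) (proj-child prp h p≢a p≢b k) hp (proj-child prq h q≢a q≢b k) hq)

  ∈pt-reduct : ∀ {r G} → Enabled G → r ∈pt reduct G → r ∈pt G
  ∈pt-reduct {G = G} (at-redex {lab = lab} h) r∈ =
    pt-sub h (find lab) (∈pt-resp-≈ (reduct-redex G h) r∈)
  ∈pt-reduct {G = G} (under h apart e) r∈ with ∈pt-inv (reduct-root G h apart) r∈
  ... | inj₁ r≡a = pt-snd h r≡a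
  ... | inj₂ (inj₁ r≡b) = pt-rcv h r≡b
  ... | inj₂ (inj₂ (k , r∈k)) =
    pt-sub h k (∈pt-reduct (e k) (∈pt-resp-≈ (reduct-child G h apart (toℕ k)) r∈k))

  unavoidable-reduct : ∀ {r G} → r ≢ p → r ≢ q → Enabled G → Unavoidable r G → Unavoidable r (reduct G)
  unavoidable-reduct {G = G} r≢p r≢q (at-redex {lab = lab} h) u with unavoidable-inv h u
  ... | inj₁ r∈pq = ⊥-elim ([ r≢p , r≢q ]′ r∈pq)
  ... | inj₂ uₖ = unavoidable-resp-≈ (≈-sym (reduct-redex G h)) (uₖ (find lab))
  unavoidable-reduct {G = G} r≢p r≢q (under h apart e) u with unavoidable-inv h u
  ... | inj₁ r∈ab = here (reduct-root G h apart) r∈ab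
  ... | inj₂ uₖ = there (reduct-root G h apart) (λ k →
    unavoidable-resp-≈ (≈-sym (reduct-child G h apart (toℕ k)))
      (unavoidable-reduct r≢p r≢q (e k) (uₖ k)))

  ∉pt-reduct : ∀ {r G} → r ≢ p → r ≢ q → Enabled G → UnavoidableOrAbsent G r →
               ¬ r ∈pt reduct G → ¬ r ∈pt G
  ∉pt-reduct r≢p r≢q e (inj₁ u) r∉ = ⊥-elim (r∉ (unavoidable⇒∈pt (unavoidable-reduct r≢p r≢q e u)))
  ∉pt-reduct r≢p r≢q e (inj₂ r∉G) r∉ = r∉G

  unavoidableOrAbsent-reduct-bystander : ∀ {r G} → r ≢ p → r ≢ q → Enabled G →
    UnavoidableOrAbsent G r → UnavoidableOrAbsent (reduct G) r
  unavoidableOrAbsent-reduct-bystander r≢p r≢q e (inj₁ u) = inj₁ (unavoidable-reduct r≢p r≢q e u)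
  unavoidableOrAbsent-reduct-bystander r≢p r≢q e (inj₂ r∉) = inj₂ (r∉ ∘ ∈pt-reduct e)

  proj-reduct-bystander : ∀ {r G T} → r ≢ p → r ≢ q → AllUnavoidable G → Enabled G →
                          Proj r G T → Proj r (reduct G) T
  proj-reduct-bystander {r} {G} r≢p r≢q allG e (R , closed , rel) =
    R′ , closed′ , (G , rel , allG , inj₂ (e , ≈-refl))
    where
    R′ : GType → LType → Set
    R′ X U = Σ[ Z ∈ GType ] (R Z U × AllUnavoidable Z × (Z ≈ X ⊎ (Enabled Z × reduct Z ≈ X)))

    unchanged : ∀ {Z X U} → R Z U → AllUnavoidable Z → Z ≈ X → ProjStep R′ r X U
    unchanged rel allZ Z≈X =
      ProjStep-map (λ r∉X → r∉X ∘ ∈pt-resp-≈ Z≈X) (sym (Z≈X []))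
        (λ h k rel′ → _ , rel′ , allUnavoidable-child allZ h k , inj₁ (≈-child Z≈X _)) (closed rel)

    closed′ : ∀ {X U} → R′ X U → ProjStep R′ r X U
    closed′ (Z , rel , allZ , inj₁ Z≈X) = unchanged rel allZ Z≈X
    closed′ (Z , rel , allZ , inj₂ (at-redex {lab = lab} h , Z′≈X)) =
      unchanged (proj₂ (proj₂ (projCases (R , closed , rel) h)) r≢p r≢q (find lab))
        (allUnavoidable-child allZ h (find lab)) (≈-trans (≈-sym (reduct-redex Z h)) Z′≈X)
    closed′ {X} {U} (Z , rel , allZ , inj₂ (e′@(under h apart e) , Z′≈X)) =
      ProjStep-map (λ r∉X → ∉pt-reduct r≢p r≢q e′ (allZ Z sub-here r) (r∉X ∘ ∈pt-resp-≈ Z′≈X))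
        (trans (sym (Z′≈X [])) (trans (reduct-root Z h apart) (sym h))) below (closed rel)
      where
      below : ∀ {a b n lab Ss} → groot Z ≡ gmsg a b n lab Ss → (k : Fin (suc n)) → ∀ {V} →
              R (gchild Z (toℕ k)) V → R′ (gchild X (toℕ k)) V
      below h′ k rel′ with trans (sym h) h′
      ... | refl = gchild Z (toℕ k) , rel′ , allUnavoidable-child allZ h k ,
                   inj₂ (e k , ≈-trans (≈-sym (reduct-child Z h apart (toℕ k))) (≈-child Z′≈X (toℕ k)))

  Active : Part → Set
  Active r = r ≡ p ⊎ r ≡ q

  active-apart : ∀ {r a b} → Active r → Apart a b → r ≢ a × r ≢ b
  active-apart (inj₁ refl) (p≢a , p≢b , _) = p≢a , p≢b
  active-apart (inj₂ refl) (_ , _ , q≢a , q≢b) = q≢a , q≢b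

  ContinuesAs : Part → LType → LType → Set₁
  ContinuesAs r U V = ∀ {G n lab Ss} → groot G ≡ gmsg p q n lab Ss →
                      Proj r G U → Proj r (gchild G (toℕ (find lab))) V

  continuesAs-sender : ∀ {U S U′} → LStep U (lout q ℓ S) U′ → ContinuesAs p U U′
  continuesAs-sender {U} (lstep-out {inj = inj} e k) {G} {lab = lab} h pr
    with proj₁ (proj₂ (projCases pr h)) refl
  ... | _ , _ , _ , root≡ , lab≗ , _ , children with trans (sym e) root≡
  ...   | refl = subst (λ j → Proj p (gchild G (toℕ (find lab))) (child U (toℕ j)))
                   (find-index inj lab≗ k refl) (proj-sub pr (children (find lab)))

  continuesAs-receiver : ∀ {U S U′} → LStep U (lin p ℓ S) U′ → ContinuesAs q U U′
  continuesAs-receiver {U} (lstep-in {inj = inj} e k) {G} {lab = lab} h pr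
    with proj₁ (projCases pr h) refl
  ... | _ , _ , _ , root≡ , lab≗ , _ , children with trans (sym e) root≡
  ...   | refl = subst (λ j → Proj q (gchild G (toℕ (find lab))) (child U (toℕ j)))
                   (find-index inj lab≗ k refl) (proj-sub pr (children (find lab)))

  proj-reduct-active : ∀ {r G U V} → Active r → ContinuesAs r U V → Enabled G →
                       Proj r G U → Proj r (reduct G) V
  proj-reduct-active {G = G} act continues (at-redex h) pr =
    Proj-resp-≈ (≈-sym (reduct-redex G h)) (continues h pr)
  proj-reduct-active {G = G} act continues (under h apart e) pr =
    proj-intro-bystander (reduct-root G h apart) r≢a r≢b (λ k →
      Proj-resp-≈ (≈-sym (reduct-child G h apart (toℕ k)))
        (proj-reduct-active act continues (e k) (proj-child pr h r≢a r≢b k)))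
    where
    r≢a = proj₁ (active-apart act apart)
    r≢b = proj₂ (active-apart act apart)

  unavoidableOrAbsent-reduct-active : ∀ {r G U V} → Active r → ContinuesAs r U V →
    AllUnavoidable G → Enabled G → Proj r G U → UnavoidableOrAbsent (reduct G) r
  unavoidableOrAbsent-reduct-active {r} {G} act continues allG (at-redex {lab = lab} h) pr =
    unavoidableOrAbsent-resp-≈ (≈-sym (reduct-redex G h))
      (allUnavoidable-child allG h (find lab) _ sub-here r)
  unavoidableOrAbsent-reduct-active {G = G} act continues allG (under h apart e) pr =
    unavoidableOrAbsent-uniform (reduct-root G h apart) r≢a r≢b
      (λ k → unavoidableOrAbsent-resp-≈ (≈-sym (reduct-child G h apart (toℕ k)))
               (unavoidableOrAbsent-reduct-active act continues
                  (allUnavoidable-child allG h k) (e k) (prₖ k)))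
      (λ k → Proj-resp-≈ (≈-sym (reduct-child G h apart (toℕ k)))
               (proj-reduct-active act continues (e k) (prₖ k)))
    where
    r≢a = proj₁ (active-apart act apart)
    r≢b = proj₂ (active-apart act apart)
    prₖ = proj-child pr h r≢a r≢b

  allUnavoidable-reduct : ∀ {G Up Vp Uq Vq} →
    ContinuesAs p Up Vp → Proj p G Up → ContinuesAs q Uq Vq → Proj q G Uq →
    AllUnavoidable G → Enabled G → AllUnavoidable (reduct G)
  allUnavoidable-reduct {G} _ _ _ _ allG (at-redex {lab = lab} h) =
    allUnavoidable-resp-≈ (≈-sym (reduct-redex G h)) (allUnavoidable-child allG h (find lab))
  allUnavoidable-reduct {G} continuesP prp continuesQ prq allG
                        e@(under h apart@(p≢a , p≢b , q≢a , q≢b) eₖ) =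
    allUnavoidable-intro (reduct-root G h apart) atRoot (λ k →
      allUnavoidable-resp-≈ (≈-sym (reduct-child G h apart (toℕ k)))
        (allUnavoidable-reduct continuesP (proj-child prp h p≢a p≢b k)
                               continuesQ (proj-child prq h q≢a q≢b k)
          (allUnavoidable-child allG h k) (eₖ k)))
    where
    atRoot : ∀ r → UnavoidableOrAbsent (reduct G) r
    atRoot r with r ≟ p | r ≟ q
    ... | yes refl | _ = unavoidableOrAbsent-reduct-active (inj₁ refl) continuesP allG e prp
    ... | no _ | yes refl = unavoidableOrAbsent-reduct-active (inj₂ refl) continuesQ allG e prq
    ... | no r≢p | no r≢q = unavoidableOrAbsent-reduct-bystander r≢p r≢q e (allG G sub-here r)

  offered : ∀ {G Up S Up′ Uq} → Enabled G → Proj p G Up → LStep Up (lout q ℓ S) Up′ →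
            Proj q G Uq → Σ[ Uq′ ∈ LType ] LStep Uq (lin p ℓ S) Uq′
  offered (at-redex h) prp (lstep-out e k) prq
    with proj₁ (proj₂ (projCases prp h)) refl | proj₁ (projCases prq h) refl
  ... | _ , _ , _ , rootP≡ , labP≗ , SsP≗ , _ | _ , _ , _ , rootQ≡ , labQ≗ , SsQ≗ , _
    with trans (sym e) rootP≡
  ...   | refl = _ , subst₂ (λ ℓ′ S′ → LStep _ (lin p ℓ′ S′) _)
                       (trans (labQ≗ k) (sym (labP≗ k))) (trans (SsQ≗ k) (sym (SsP≗ k)))
                       (lstep-in rootQ≡ k)
  offered (under h (p≢a , p≢b , q≢a , q≢b) e) prp send prq =
    offered (e fzero) (proj-child prp h p≢a p≢b fzero) send (proj-child prq h q≢a q≢b fzero)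

  ⊑-reduct : ∀ {Δ Δ′ G Tp Vp Tq Vq} → Δ ⊑ G → AllUnavoidable G → Enabled G →
    lookup Δ′ p ≡ just Tp → Proj p (reduct G) Vp → Tp ≤ₗ Vp →
    lookup Δ′ q ≡ just Tq → Proj q (reduct G) Vq → Tq ≤ₗ Vq →
    (∀ r → r ≢ p → r ≢ q → lookup Δ′ r ≡ lookup Δ r) → Δ′ ⊑ reduct G
  ⊑-reduct {Δ} {Δ′} {G} (associated , idle) allG e foundP prp Tp≤Vp foundQ prq Tq≤Vq others =
    associated′ , idle′
    where
    associated′ : ∀ r → r ∈pt reduct G →
                  Σ[ T ∈ LType ] (lookup Δ′ r ≡ just T × Σ[ U ∈ LType ] (Proj r (reduct G) U × T ≤ₗ U))
    associated′ r r∈ with r ≟ p | r ≟ q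
    ... | yes refl | _ = _ , foundP , _ , prp , Tp≤Vp
    ... | no _ | yes refl = _ , foundQ , _ , prq , Tq≤Vq
    ... | no r≢p | no r≢q with associated r (∈pt-reduct e r∈)
    ...   | T , found , U , pr , T≤U =
      T , trans (others r r≢p r≢q) found , U , proj-reduct-bystander r≢p r≢q allG e pr , T≤U

    idle′ : ∀ r → ¬ r ∈pt reduct G → Idle Δ′ r
    idle′ r r∉ with r ≟ p | r ≟ q
    ... | yes refl | _ = inj₂ (_ , foundP , ≤ₗ-end Tp≤Vp (proj-∉pt prp r∉))
    ... | no _ | yes refl = inj₂ (_ , foundQ , ≤ₗ-end Tq≤Vq (proj-∉pt prq r∉))
    ... | no r≢p | no r≢q =
      idle-resp {Δ} {Δ′} (others r r≢p r≢q) (idle r (∉pt-reduct r≢p r≢q e (allG G sub-here r) r∉))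

  record Handshake (G : GType) (T′ U : LType) (S : Sort) : Set₁ where
    field
      receivedSort   : Sort
      continuation   : LType
      receives       : LStep U (lin p ℓ receivedSort) continuation
      sent≤received  : S ≤ₛ receivedSort
      isEnabled      : Enabled G
      reductBalanced : AllUnavoidable (reduct G)
      senderType     : LType
      senderProj     : Proj p (reduct G) senderType
      sender≤        : T′ ≤ₗ senderType
      receiverType   : LType
      receiverProj   : Proj q (reduct G) receiverType
      receiver≤      : continuation ≤ₗ receiverType

  -- At a message p → q both projections show the labels and sorts of that one
  -- message; q's own type offers at least the branches of its projection, with
  -- larger sorts.
  handshake : ∀ {Δ G T S T′ U ℓ′ S′ U′} → Δ ⊑ G → AllUnavoidable G →
              lookup Δ p ≡ just T → LStep T (lout q ℓ S) T′ →
              lookup Δ q ≡ just U → LStep U (lin p ℓ′ S′) U′ → Handshake G T′ U S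
  handshake {Δ} {G} Δ⊑G allG foundT send foundU anyReceive =
    let Up , prp , T≤Up = ⊑-lookup {Δ} Δ⊑G (allG G sub-here p) foundT (LStep-not-end send)
        Uq , prq , U≤Uq = ⊑-lookup {Δ} Δ⊑G (allG G sub-here q) foundU (LStep-not-end anyReceive)
        S₁ , Up′ , S≤S₁ , sendUp , T′≤Up′ = ≤ₗ-out T≤Up send
        e = enabled (unavoidable-from-proj (allG G sub-here p) prp (LStep-not-end sendUp))
                    prp (LStep-out-head sendUp)
                    prq (trans (sym (≤ₗ-head U≤Uq)) (LStep-in-head anyReceive))
        Uq′ , receiveUq = offered e prp sendUp prq
        S₂ , U″ , S₁≤S₂ , receiveU , U″≤Uq′ = ≤ₗ-in U≤Uq receiveUq
    in record
      { receivedSort   = S₂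
      ; continuation   = U″
      ; receives       = receiveU
      ; sent≤received  = ≤ₛ-trans S≤S₁ S₁≤S₂
      ; isEnabled      = e
      ; reductBalanced = allUnavoidable-reduct (continuesAs-sender sendUp) prp
                           (continuesAs-receiver receiveUq) prq allG e
      ; senderType     = Up′
      ; senderProj     = proj-reduct-active (inj₁ refl) (continuesAs-sender sendUp) e prp
      ; sender≤        = T′≤Up′
      ; receiverType   = Uq′
      ; receiverProj   = proj-reduct-active (inj₂ refl) (continuesAs-receiver receiveUq) e prq
      ; receiver≤      = U″≤Uq′
      }

  preservation : ∀ {Δ Δ′ G} → Δ ⊑ G → AllUnavoidable G → EStep Δ (ecom p q ℓ) Δ′ →
                 Δ′ ⊑ reduct G × AllUnavoidable (reduct G)
  preservation {Δ} Δ⊑G allG (e-com {T' = T′} {U' = U′} p≢q foundT send foundU receive _) =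
    ⊑-reduct {Δ} {update (update Δ p T′) q U′} Δ⊑G allG isEnabled foundT′ senderProj sender≤
      foundU′ receiverProj (subst (_≤ₗ receiverType) continuation≡U′ receiver≤) others ,
    reductBalanced
    where
    open Handshake (handshake {Δ} Δ⊑G allG foundT send foundU receive)

    continuation≡U′ : continuation ≡ U′
    continuation≡U′ = LStep-in-deterministic receives receive refl

    foundT′ : lookup (update (update Δ p T′) q U′) p ≡ just T′
    foundT′ = trans (lookup-update-≢ (update Δ p T′) U′ p≢q) (lookup-update-≡ Δ foundT)

    foundU′ : lookup (update (update Δ p T′) q U′) q ≡ just U′
    foundU′ = lookup-update-≡ (update Δ p T′) (trans (lookup-update-≢ Δ T′ (p≢q ∘ sym)) foundU)

    others : ∀ r → r ≢ p → r ≢ q → lookup (update (update Δ p T′) q U′) r ≡ lookup Δ r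
    others r r≢p r≢q = trans (lookup-update-≢ (update Δ p T′) U′ r≢q) (lookup-update-≢ Δ T′ r≢p)

  progress : ∀ {Δ G S ℓ′ S′} → Δ ⊑ G → AllUnavoidable G →
             Can Δ (eout p q ℓ S) → Can Δ (einp q p ℓ′ S′) → Can Δ (ecom p q ℓ)
  progress {Δ} Δ⊑G allG (_ , e-out foundT send) (_ , e-inp foundU receive) =
    _ , e-com (sender≢receiver {Δ} foundT send foundU receive)
              foundT send foundU receives sent≤received
    where
    open Handshake (handshake {Δ} Δ⊑G allG foundT send foundU receive)

Compatible : Env → Set
Compatible Δ = ∀ p q ℓ S ℓ′ S′ → Can Δ (eout p q ℓ S) → Can Δ (einp q p ℓ′ S′) → Can Δ (ecom p q ℓ)

invariant⇒safe : ∀ {Γ} (I : Env → Set₁) → (∀ {Δ} → I Δ → Compatible Δ) →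
                 (∀ {Δ Δ′} → I Δ → Δ ⟶ Δ′ → I Δ′) → I Γ → Safe Γ
invariant⇒safe {Γ} I compatible preserved IΓ =
  Star _⟶_ Γ , (λ Γ↠Δ → compatible (holds IΓ Γ↠Δ) , λ _ Δ⟶Δ′ → Γ↠Δ ◅◅ (Δ⟶Δ′ ◅ ε)) , ε
  where
  holds : ∀ {Δ₀ Δ} → I Δ₀ → Star _⟶_ Δ₀ Δ → I Δ
  holds IΔ₀ ε = IΔ₀
  holds IΔ₀ (Δ₀⟶Δ₁ ◅ Δ₁↠Δ) = holds (preserved IΔ₀ Δ₀⟶Δ₁) Δ₁↠Δ

Associated : Env → Set₁
Associated Δ = Σ[ G ∈ GType ] (AllUnavoidable G × Δ ⊑ G)

associated-compatible : ∀ {Δ} → Associated Δ → Compatible Δ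
associated-compatible (G , allG , Δ⊑G) p q ℓ _ _ _ = Communication.progress p q ℓ Δ⊑G allG

associated-preserved : ∀ {Δ Δ′} → Associated Δ → Δ ⟶ Δ′ → Associated Δ′
associated-preserved (G , allG , Δ⊑G) (p , q , ℓ , Δ⟶Δ′)
  with Communication.preservation p q ℓ Δ⊑G allG Δ⟶Δ′
... | Δ′⊑G′ , allG′ = Communication.reduct p q ℓ G , allG′ , Δ′⊑G′

mainTheorem3 : (Γ : Env) (G : GType) → UniqueKeys Γ → Balanced G →
    (∀ p → Projectable p G) → Γ ⊑ G → Safe Γ
mainTheorem3 Γ G _ balanced _ Γ⊑G =
  invariant⇒safe Associated associated-compatible associated-preserved
    (G , balanced⇒allUnavoidable balanced , Γ⊑G)
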